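{- Let $n\ge 2$ and let $A\in M$ have degree $k$ and multiplicity $1$. Write $A$ as the multiset $[y_1,\ldots,y_k]$ with $y_1\ge y_2\ge\cdots\ge y_k$ (consisting of $a_i$ copies of $i$ for each $i$). If $k\ge\lfloor n/2\rfloor+2$ then $y_{k-2}=y_{k-1}=y_k=1$. If $k\ge\lceil n/2\rceil+1$ then $y_{k-1}=y_k=1$.
   Context: Let $\mathbb{N}=\{0,1,2,\ldots\}$ and $M=\{(a_1,\ldots,a_{n-1})\in\mathbb{N}^{n-1} : a_1+2a_2+\cdots+(n-1)a_{n-1}\equiv 0 \pmod n\}$. For $A\in M$, $\deg(A)=a_1+\cdots+a_{n-1}$ and the multiplicity is $m(A)=(a_1+2a_2+\cdots+(n-1)a_{n-1})/n$. Here $\lceil n/2\rceil=n-\lfloor n/2\rfloor$. -}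

module Defs where

open import Data.Nat using (ℕ; zero; suc; _+_; _*_; _∸_; pred)
import Data.Nat
open import Data.Fin using (Fin; toℕ)
open import Data.List using (List; []; _∷_; _++_; replicate; length; lookup; reverse; concat; map)
open import Data.List.Base using (allFin)
open import Data.Maybe using (Maybe; just; nothing)
open import Data.Nat.ListAction using (sum)
open import Data.Nat.Divisibility using (_∣_)
open import Data.Nat.DivMod using (_/_)

-- An element A = (a_1,…,a_{n-1}) ∈ ℕ^{n-1} is a function  a : Fin (pred n) → ℕ,
-- where  a j  is the coefficient a_{toℕ j + 1}.

idx : {n : ℕ} → Fin n → ℕ
idx j = suc (toℕ j)

weight : (n : ℕ) → (Fin (pred n) → ℕ) → ℕ
weight n a = sum (map (λ j → idx j * a j) (allFin (pred n)))

deg : (n : ℕ) → (Fin (pred n) → ℕ) → ℕ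
deg n a = sum (map a (allFin (pred n)))

-- The multiset [y_1,…,y_k] listed in non-increasing order:
-- a_{n-1} copies of n-1, then a_{n-2} copies of n-2, …, then a_1 copies of 1.
sortedDesc : (n : ℕ) → (Fin (pred n) → ℕ) → List ℕ
sortedDesc n a = concat (reverse (map (λ j → replicate (a j) (idx j)) (allFin (pred n))))

-- 1-indexed access: y i = just y_i for 1 ≤ i ≤ k, nothing otherwise
yAt : List ℕ → ℕ → Maybe ℕ
yAt xs zero = nothing
yAt [] (suc i) = nothing
yAt (x ∷ xs) (suc zero) = just x
yAt (x ∷ xs) (suc (suc i)) = yAt xs (suc i)

InM : (n : ℕ) → (Fin (pred n) → ℕ) → Set
InM n a = n ∣ weight n a

mult : (n : ℕ) .{{_ : Data.Nat.NonZero n}} → (Fin (pred n) → ℕ) → ℕ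
mult n a = weight n a / n

{-# OPTIONS --safe #-}
-- The parts of A equal to 1 number a₁, and every other part contributes at least 2 to the
-- weight a₁ + 2a₂ + ⋯, which equals n because m(A) = 1. Hence 2k ≤ n + a₁, i.e. the sorted
-- multiset ends in at least 2k − n ones; each threshold on k makes this at least 3, resp. 2.
module Submission where

open import Defs
open import Data.Nat using (ℕ; suc; _+_; _*_; _∸_; _≤_; _<_; s≤s; z≤n; pred; ⌊_/2⌋; ⌈_/2⌉; NonZero)
open import Data.Nat.Properties
open import Data.Nat.DivMod using (m/n*n≡m)
open import Data.Nat.ListAction using (sum)
open import Data.Nat.Tactic.RingSolver using (solve-∀)
open import Data.Fin using (Fin; zero; suc)
open import Data.List using (List; []; _∷_; _++_; replicate; length; reverse; concat; map; tabulate)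
open import Data.List.Properties using (unfold-reverse; concat-++; ++-identityʳ; length-++; length-replicate)
open import Data.List.Relation.Unary.All using (All; []; _∷_)
open import Data.List.Relation.Unary.All.Properties using (tabulate⁺)
open import Data.Maybe using (just)
open import Data.Product using (_×_; _,_)
open import Relation.Binary.PropositionalEquality using (_≡_; refl; sym; trans; cong; cong₂; module ≡-Reasoning)

⌊n/2⌋+2≤k⇒n+3≤k+k : ∀ {n k} → ⌊ n /2⌋ + 2 ≤ k → n + 3 ≤ k + k
⌊n/2⌋+2≤k⇒n+3≤k+k {n} {k} h = begin
  n + 3                    ≡⟨ cong (_+ 3) (sym (⌊n/2⌋+⌈n/2⌉≡n n)) ⟩
  (f + ⌈ n /2⌉) + 3        ≤⟨ +-monoˡ-≤ 3 (+-monoʳ-≤ f (⌊n/2⌋-mono (n≤1+n (suc n)))) ⟩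
  (f + (1 + f)) + 3        ≡⟨ identity f ⟩
  (f + 2) + (f + 2)        ≤⟨ +-mono-≤ h h ⟩
  k + k                    ∎
  where
  open ≤-Reasoning
  f = ⌊ n /2⌋
  identity : ∀ f → (f + (1 + f)) + 3 ≡ (f + 2) + (f + 2)
  identity = solve-∀

⌈n/2⌉+1≤k⇒n+2≤k+k : ∀ {n k} → ⌈ n /2⌉ + 1 ≤ k → n + 2 ≤ k + k
⌈n/2⌉+1≤k⇒n+2≤k+k {n} {k} h = begin
  n + 2                    ≡⟨ cong (_+ 2) (sym (⌊n/2⌋+⌈n/2⌉≡n n)) ⟩
  (⌊ n /2⌋ + c) + 2        ≤⟨ +-monoˡ-≤ 2 (+-monoˡ-≤ c (⌊n/2⌋≤⌈n/2⌉ n)) ⟩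
  (c + c) + 2              ≡⟨ identity c ⟩
  (c + 1) + (c + 1)        ≤⟨ +-mono-≤ h h ⟩
  k + k                    ∎
  where
  open ≤-Reasoning
  c = ⌈ n /2⌉
  identity : ∀ c → (c + c) + 2 ≡ (c + 1) + (c + 1)
  identity = solve-∀

*-sum-≤-sum-weighted : ∀ {A : Set} c (w a : A → ℕ) {xs : List A} → All (λ x → c ≤ w x) xs →
  c * sum (map a xs) ≤ sum (map (λ x → w x * a x) xs)
*-sum-≤-sum-weighted c w a []                  = ≤-reflexive (*-zeroʳ c)
*-sum-≤-sum-weighted c w a {x ∷ xs} (c≤wx ∷ h) = begin
  c * (a x + sum (map a xs))        ≡⟨ *-distribˡ-+ c (a x) _ ⟩
  c * a x + c * sum (map a xs)      ≤⟨ +-mono-≤ (*-monoˡ-≤ (a x) c≤wx) (*-sum-≤-sum-weighted c w a h) ⟩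
  w x * a x + _                     ∎
  where open ≤-Reasoning

concat-reverse-∷ : ∀ {A : Set} (xs : List A) (xss : List (List A)) →
  concat (reverse (xs ∷ xss)) ≡ concat (reverse xss) ++ xs
concat-reverse-∷ xs xss = begin
  concat (reverse (xs ∷ xss))          ≡⟨ cong concat (unfold-reverse xs xss) ⟩
  concat (reverse xss ++ xs ∷ [])      ≡⟨ sym (concat-++ (reverse xss) (xs ∷ [])) ⟩
  concat (reverse xss) ++ (xs ++ [])   ≡⟨ cong (concat (reverse xss) ++_) (++-identityʳ xs) ⟩
  concat (reverse xss) ++ xs           ∎
  where open ≡-Reasoning

yAt-replicate : ∀ c (x : ℕ) {i} → 0 < i → i ≤ c → yAt (replicate c x) i ≡ just x
yAt-replicate (suc c) x {1}           _ _         = refl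
yAt-replicate (suc c) x {suc (suc i)} _ (s≤s i<c) = yAt-replicate c x (s≤s z≤n) i<c

yAt-++-replicate : ∀ (ys : List ℕ) c x {i} → length ys < i → i ≤ length ys + c →
  yAt (ys ++ replicate c x) i ≡ just x
yAt-++-replicate []       c x 0<i i≤c = yAt-replicate c x 0<i i≤c
yAt-++-replicate (y ∷ ys) c x {suc (suc i)} (s≤s ys<i) (s≤s i≤ys+c) =
  yAt-++-replicate ys c x ys<i i≤ys+c

yAt-++-replicate-∸ : ∀ (ys : List ℕ) c x {k j} → length ys + c ≡ k → j < c →
  yAt (ys ++ replicate c x) (k ∸ j) ≡ just x
yAt-++-replicate-∸ ys c x {k} {j} refl j<c =
  yAt-++-replicate ys c x (m+n≤o⇒m≤o∸n (suc (length ys)) ys+j<k) (m∸n≤m k j)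
  where
  ys+j<k : suc (length ys) + j ≤ k
  ys+j<k = ≤-trans (≤-reflexive (sym (+-suc (length ys) j))) (+-monoʳ-≤ (length ys) j<c)

block : ∀ {p} → (Fin p → ℕ) → Fin p → List ℕ
block a j = replicate (a j) (idx j)

length-concat-reverse-blocks : ∀ {p} (a : Fin p → ℕ) (js : List (Fin p)) →
  length (concat (reverse (map (block a) js))) ≡ sum (map a js)
length-concat-reverse-blocks a []       = refl
length-concat-reverse-blocks a (j ∷ js) = begin
  length (concat (reverse (block a j ∷ bs)))                ≡⟨ cong length (concat-reverse-∷ (block a j) bs) ⟩
  length (concat (reverse bs) ++ block a j)                 ≡⟨ length-++ (concat (reverse bs)) ⟩
  length (concat (reverse bs)) + length (block a j)         ≡⟨ cong₂ _+_ (length-concat-reverse-blocks a js) (length-replicate (a j)) ⟩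
  sum (map a js) + a j                                      ≡⟨ +-comm (sum (map a js)) (a j) ⟩
  a j + sum (map a js)                                      ∎
  where
  open ≡-Reasoning
  bs = map (block a) js

module _ {m : ℕ} (a : Fin (suc m) → ℕ) where

  private
    n : ℕ
    n = 2 + m

  deg+deg≤weight+a₁ : deg n a + deg n a ≤ weight n a + a zero
  deg+deg≤weight+a₁ = begin
    (a₁ + d) + (a₁ + d)      ≡⟨ identity a₁ d ⟩
    (1 * a₁ + 2 * d) + a₁    ≤⟨ +-monoˡ-≤ a₁ (+-monoʳ-≤ (1 * a₁) 2d≤w) ⟩
    (1 * a₁ + w) + a₁        ∎
    where
    open ≤-Reasoning
    a₁ = a zero
    d  = sum (map a (tabulate suc))
    w  = sum (map (λ j → idx j * a j) (tabulate suc))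
    2d≤w : 2 * d ≤ w
    2d≤w = *-sum-≤-sum-weighted 2 idx a {tabulate suc} (tabulate⁺ (λ _ → s≤s (s≤s z≤n)))
    identity : ∀ a₁ d → (a₁ + d) + (a₁ + d) ≡ (1 * a₁ + 2 * d) + a₁
    identity = solve-∀

  sortedDesc-last-ones : ∀ {j} → j < a zero → yAt (sortedDesc n a) (deg n a ∸ j) ≡ just 1
  sortedDesc-last-ones j<a₁ rewrite concat-reverse-∷ (block a zero) (map (block a) (tabulate suc)) =
    yAt-++-replicate-∸ rest (a zero) 1 length-rest+a₁≡deg j<a₁
    where
    rest = concat (reverse (map (block a) (tabulate suc)))
    length-rest+a₁≡deg : length rest + a zero ≡ deg n a
    length-rest+a₁≡deg = trans (cong (_+ a zero) (length-concat-reverse-blocks a (tabulate suc)))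
                               (+-comm _ (a zero))

mult≡1⇒weight≡n : ∀ n .{{_ : NonZero n}} (a : Fin (pred n) → ℕ) → InM n a → mult n a ≡ 1 → weight n a ≡ n
mult≡1⇒weight≡n n a n∣w mult≡1 = begin
  weight n a      ≡⟨ sym (m/n*n≡m n∣w) ⟩
  mult n a * n    ≡⟨ cong (_* n) mult≡1 ⟩
  1 * n           ≡⟨ *-identityˡ n ⟩
  n               ∎
  where open ≡-Reasoning

mainTheorem3 : (n : ℕ) .{{_ : NonZero n}} → 2 ≤ n → (a : Fin (pred n) → ℕ) → (k : ℕ) →
    InM n a → deg n a ≡ k → mult n a ≡ 1 →
    ((⌊ n /2⌋ + 2 ≤ k →
        (yAt (sortedDesc n a) (k ∸ 2) ≡ just 1 ×
         yAt (sortedDesc n a) (k ∸ 1) ≡ just 1 ×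
         yAt (sortedDesc n a) k ≡ just 1))
    × (⌈ n /2⌉ + 1 ≤ k →
        (yAt (sortedDesc n a) (k ∸ 1) ≡ just 1 ×
         yAt (sortedDesc n a) k ≡ just 1)))
mainTheorem3 n@(suc (suc m)) (s≤s (s≤s _)) a k n∣w refl mult≡1 =
    (λ h → let 3≤a₁ = enough-ones (⌊n/2⌋+2≤k⇒n+3≤k+k {n} h) in
      one 3≤a₁ , one (≤-trans (s≤s (s≤s z≤n)) 3≤a₁) , one (≤-trans (s≤s z≤n) 3≤a₁))
  , (λ h → let 2≤a₁ = enough-ones (⌈n/2⌉+1≤k⇒n+2≤k+k {n} h) in
      one 2≤a₁ , one (≤-trans (s≤s z≤n) 2≤a₁))
  where
  one : ∀ {j} → j < a zero → yAt (sortedDesc n a) (deg n a ∸ j) ≡ just 1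
  one = sortedDesc-last-ones a
  k+k≤n+a₁ : deg n a + deg n a ≤ n + a zero
  k+k≤n+a₁ = ≤-trans (deg+deg≤weight+a₁ a) (≤-reflexive (cong (_+ a zero) (mult≡1⇒weight≡n n a n∣w mult≡1)))
  enough-ones : ∀ {r} → n + r ≤ deg n a + deg n a → r ≤ a zero
  enough-ones h = +-cancelˡ-≤ n _ _ (≤-trans h k+k≤n+a₁)
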